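{- Let $n \ge 3$, let $G = K_n$ be the complete graph of order $n$, and let $\sigma: V(G_1) \rightarrow V(G_2)$ be a bijection. Then $\dim(C(K_n, \sigma)) = n-1$.
   Context: For a connected graph $H$, a set $S \subseteq V(H)$ is a resolving set if for every two distinct vertices $x,y$ of $H$ there is $s \in S$ with $d_H(x,s) \neq d_H(y,s)$; the metric dimension $\dim(H)$ is the minimum cardinality of a resolving set of $H$. Given a graph $G$, let $G_1$ and $G_2$ be disjoint copies of $G$ and let $f: V(G_1)\to V(G_2)$ be a function. The functigraph $C(G,f)$ is the graph with vertex set $V(G_1)\cup V(G_2)$ and edge set $E(G_1)\cup E(G_2)\cup\{uv \mid u \in V(G_1),\ v=f(u)\}$. -}

module Defs where

open import Level using (Level; _⊔_) renaming (suc to lsuc)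
open import Data.Nat using (ℕ; zero; suc; _≤_)
open import Data.Fin using (Fin)
open import Data.Sum using (_⊎_; inj₁; inj₂)
open import Data.Product using (Σ; ∃; _×_; _,_)
open import Data.List using (List; length)
open import Data.List.Membership.Propositional using (_∈_)
open import Data.List.Relation.Unary.Unique.Propositional using (Unique)
open import Relation.Nullary using (¬_)
open import Relation.Binary.PropositionalEquality using (_≡_; _≢_)

record Graph : Set₁ where
  field
    V   : Set
    Adj : V → V → Set

open Graph public

data Walk (G : Graph) : V G → V G → ℕ → Set where
  nil  : ∀ {x} → Walk G x x zero
  cons : ∀ {x y z k} → Adj G x y → Walk G y z k → Walk G x z (suc k)

Dist : (G : Graph) → V G → V G → ℕ → Set
Dist G x y k = Walk G x y k × (∀ j → Walk G x y j → k ≤ j)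

-- S (a finite set of vertices, given as a duplicate-free list) is resolving.
Resolving : (G : Graph) → List (V G) → Set
Resolving G S =
  ∀ x y → x ≢ y →
    Σ (V G) λ s → s ∈ S × Σ ℕ λ dx → Σ ℕ λ dy →
      Dist G x s dx × Dist G y s dy × dx ≢ dy

MetricDim : (G : Graph) → ℕ → Set
MetricDim G d =
  (Σ (List (V G)) λ S → Unique S × Resolving G S × length S ≡ d)
  × (∀ S → Unique S → Resolving G S → d ≤ length S)

K : ℕ → Graph
K n = record { V = Fin n ; Adj = λ a b → a ≢ b }

-- Functigraph C(G, f): vertices V(G₁) ⊎ V(G₂), edges of both copies plus u f(u).
FAdj : (G : Graph) → (V G → V G) → V G ⊎ V G → V G ⊎ V G → Set
FAdj G f (inj₁ a) (inj₁ b) = Adj G a b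
FAdj G f (inj₂ a) (inj₂ b) = Adj G a b
FAdj G f (inj₁ a) (inj₂ b) = b ≡ f a
FAdj G f (inj₂ b) (inj₁ a) = b ≡ f a

Functigraph : (G : Graph) → (V G → V G) → Graph
Functigraph G f = record { V = V G ⊎ V G ; Adj = FAdj G f }

module Submission where

-- Write C for C(Kₙ, σ); its copy-1 vertices are u_a, its copy-2 vertices v_b,
-- and v_b ~ u_a exactly when b = σ a.  All distances in C are at most 2.
--
-- Upper bound: the n − 1 copy-1 vertices u_1, …, u_{n−1} form a resolving set.
--   Two copy-1 vertices are told apart by whichever of them is a landmark
--   (distance 0 versus 1); u_a and v_b by a landmark u_c with b ≠ σ c, which
--   exists among u_1, u_2 because n ≥ 3 (distance ≤ 1 versus 2); v_a and v_b by
--   the landmark matched to one of them (distance 1 versus 2).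
-- Lower bound: call a the owner of both u_a and v_{σ a}.  A vertex s sees every
--   copy-1 vertex u_i whose index i does not own s at the same distance (1 or 2,
--   according to the copy of s).  Hence a resolving set must own one of any two
--   distinct indices, so it owns all but at most one index and has ≥ n − 1 elements.

open import Defs
open import Data.Nat using (ℕ; _≤_; _∸_)
open import Data.Fin using (Fin)
open import Function.Definitions using (Bijective)
open import Relation.Binary.PropositionalEquality using (_≡_)

open import Data.Nat using (zero; suc; z≤n; s≤s; _≤?_)
open import Data.Nat.Properties using (≤-antisym; ≰⇒>; ≤-refl; n≤1+n; ≤-trans)
open import Data.Fin using (punchIn; _≟_) renaming (zero to fzero; suc to fsuc)
open import Data.Fin.Properties using (pigeonhole; punchIn-injective; punchInᵢ≢i; all?; ¬∀⟶∃¬; <⇒≢)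
open import Data.Sum using (_⊎_; inj₁; inj₂; [_,_])
open import Data.Product using (Σ; ∃; _×_; _,_; proj₁; proj₂)
open import Data.List using (List; length; map; allFin; lookup)
open import Data.List.Properties using (length-map; length-tabulate)
open import Data.List.Membership.Propositional using (_∈_; _∉_)
open import Data.List.Membership.Propositional.Properties using (∈-map⁺; ∈-allFin)
open import Data.List.Membership.DecPropositional using () renaming (_∈?_ to member?)
open import Data.List.Relation.Unary.Any using (index)
open import Data.List.Relation.Unary.Any.Properties using (lookup-index)
open import Data.List.Relation.Unary.Unique.Propositional using (Unique)
open import Data.List.Relation.Unary.Unique.Propositional.Properties using (map⁺; allFin⁺)
open import Data.Empty using (⊥-elim)
open import Function using (id; _∘_)
open import Function.Definitions using (Injective)
open import Relation.Nullary using (¬_; yes; no; contradiction)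
open import Relation.Binary.PropositionalEquality
  using (_≢_; refl; sym; trans; cong; subst; module ≡-Reasoning)

module _ (G : Graph) where

  walk-zero : ∀ {x y} → Walk G x y 0 → x ≡ y
  walk-zero nil = refl

  walk-one : ∀ {x y} → Walk G x y 1 → Adj G x y
  walk-one (cons e nil) = e

  dist-unique : ∀ {x y k l} → Dist G x y k → Dist G x y l → k ≡ l
  dist-unique (w , k-min) (w′ , l-min) = ≤-antisym (k-min _ w′) (l-min _ w)

  dist-refl : ∀ x → Dist G x x 0
  dist-refl x = nil , λ _ _ → z≤n

  dist-adj : ∀ {x y} → x ≢ y → Adj G x y → Dist G x y 1
  dist-adj x≢y e = cons e nil , λ where
    zero    w → ⊥-elim (x≢y (walk-zero w))
    (suc _) _ → s≤s z≤n

  dist-two : ∀ {x y} → x ≢ y → ¬ Adj G x y → Walk G x y 2 → Dist G x y 2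
  dist-two x≢y ¬e w = w , λ where
    zero          w′ → ⊥-elim (x≢y (walk-zero w′))
    (suc zero)    w′ → ⊥-elim (¬e (walk-one w′))
    (suc (suc _)) _  → s≤s (s≤s z≤n)

  Separated : List (V G) → V G → V G → Set
  Separated S x y = Σ (V G) λ s → s ∈ S × Σ ℕ λ dx → Σ ℕ λ dy →
    Dist G x s dx × Dist G y s dy × dx ≢ dy

  separated-sym : ∀ {S x y} → Separated S x y → Separated S y x
  separated-sym (s , s∈S , dx , dy , Dx , Dy , dx≢dy) =
    s , s∈S , dy , dx , Dy , Dx , dx≢dy ∘ sym

injection-bound : ∀ {A : Set} {k} (L : List A) (g : Fin k → A) →
  Injective _≡_ _≡_ g → (∀ a → g a ∈ L) → k ≤ length L
injection-bound {k = k} L g g-inj g∈L with k ≤? length L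
... | yes k≤ = k≤
... | no k≰ with i , j , i<j , same-index ← pigeonhole (≰⇒> k≰) (index ∘ g∈L) =
  contradiction (g-inj g-i≡g-j) (<⇒≢ i<j)
  where
  open ≡-Reasoning
  g-i≡g-j : g i ≡ g j
  g-i≡g-j = begin
    g i                     ≡⟨ lookup-index (g∈L i) ⟩
    lookup L (index (g∈L i)) ≡⟨ cong (lookup L) same-index ⟩
    lookup L (index (g∈L j)) ≡⟨ sym (lookup-index (g∈L j)) ⟩
    g j                     ∎

-- A list over Fin (suc k) containing one of every two distinct elements misses
-- at most one element, hence has length ≥ k.
pairwise-cover-bound : ∀ {k} (L : List (Fin (suc k))) →
  (∀ i j → i ≢ j → i ∈ L ⊎ j ∈ L) → k ≤ length L
pairwise-cover-bound {k} L cover with all? (λ i → member? _≟_ i L)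
... | yes all∈L = ≤-trans (n≤1+n k) (injection-bound L id id all∈L)
... | no ¬all∈L with i , i∉L ← ¬∀⟶∃¬ _ _ (λ i → member? _≟_ i L) ¬all∈L =
  injection-bound L (punchIn i) (punchIn-injective i _ _) λ a →
    [ (λ i∈L → contradiction i∈L i∉L) , id ] (cover i (punchIn i a) (punchInᵢ≢i i a ∘ sym))

module FunctigraphOfComplete {n : ℕ} (f : Fin n → Fin n) where

  C : Graph
  C = Functigraph (K n) f

  dist-clique : ∀ {a c} → a ≢ c → Dist C (inj₁ a) (inj₁ c) 1
  dist-clique a≢c = dist-adj C (a≢c ∘ λ { refl → refl }) a≢c

  dist-clique-≤1 : ∀ a c → ∃ λ d → Dist C (inj₁ a) (inj₁ c) d × d ≤ 1
  dist-clique-≤1 a c with a ≟ c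
  ... | yes refl = 0 , dist-refl C _ , z≤n
  ... | no a≢c   = 1 , dist-clique a≢c , ≤-refl

  dist-matched : ∀ {b c} → b ≡ f c → Dist C (inj₂ b) (inj₁ c) 1
  dist-matched b≡fc = dist-adj C (λ ()) b≡fc

  dist-unmatched : ∀ {b c} → b ≢ f c → Dist C (inj₂ b) (inj₁ c) 2
  dist-unmatched {c = c} b≢fc =
    dist-two C (λ ()) b≢fc (cons {y = inj₂ (f c)} b≢fc (cons refl nil))

  dist-unmatched′ : ∀ {a b} → b ≢ f a → Dist C (inj₁ a) (inj₂ b) 2
  dist-unmatched′ {a} b≢fa =
    dist-two C (λ ()) b≢fa (cons {y = inj₂ (f a)} refl (cons (b≢fa ∘ sym) nil))

module Inverse {A : Set} (σ : A → A) (bij : Bijective _≡_ _≡_ σ) where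

  σ⁻¹ : A → A
  σ⁻¹ b = proj₁ (proj₂ bij b)

  σ∘σ⁻¹ : ∀ b → σ (σ⁻¹ b) ≡ b
  σ∘σ⁻¹ b = proj₂ (proj₂ bij b) refl

  σ⁻¹-of : ∀ {a b} → b ≡ σ a → σ⁻¹ b ≡ a
  σ⁻¹-of {a} {b} b≡σa = proj₁ bij (trans (σ∘σ⁻¹ b) b≡σa)

  σ⁻¹-partner : ∀ {a b} → σ⁻¹ b ≡ a → b ≡ σ a
  σ⁻¹-partner {b = b} σ⁻¹b≡a = trans (sym (σ∘σ⁻¹ b)) (cong σ σ⁻¹b≡a)

module LowerBound {k : ℕ} (σ : Fin (suc k) → Fin (suc k)) (bij : Bijective _≡_ _≡_ σ) where
  open FunctigraphOfComplete σ
  open Inverse σ bij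

  owner : V C → Fin (suc k)
  owner (inj₁ a) = a
  owner (inj₂ b) = σ⁻¹ b

  -- The distance at which a vertex is seen from copy-1 vertices not owning it.
  side-distance : V C → ℕ
  side-distance (inj₁ _) = 1
  side-distance (inj₂ _) = 2

  dist-from-stranger : ∀ i s → owner s ≢ i → Dist C (inj₁ i) s (side-distance s)
  dist-from-stranger i (inj₁ c) c≢i = dist-clique (c≢i ∘ sym)
  dist-from-stranger i (inj₂ b) σ⁻¹b≢i = dist-unmatched′ (σ⁻¹b≢i ∘ σ⁻¹-of)

  owners-cover : ∀ T → Resolving C T → ∀ i j → i ≢ j →
    i ∈ map owner T ⊎ j ∈ map owner T
  owners-cover T res i j i≢j with member? _≟_ i (map owner T) | member? _≟_ j (map owner T)
  ... | yes i∈ | _      = inj₁ i∈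
  ... | no _   | yes j∈ = inj₂ j∈
  ... | no i∉  | no j∉  with res (inj₁ i) (inj₁ j) (i≢j ∘ λ { refl → refl })
  ...   | s , s∈T , dx , dy , Dx , Dy , dx≢dy = contradiction (begin
    dx               ≡⟨ dist-unique C Dx (dist-from-stranger i s (not-owner i∉)) ⟩
    side-distance s  ≡⟨ dist-unique C (dist-from-stranger j s (not-owner j∉)) Dy ⟩
    dy               ∎) dx≢dy
    where
    open ≡-Reasoning
    not-owner : ∀ {x} → x ∉ map owner T → owner s ≢ x
    not-owner x∉ refl = x∉ (∈-map⁺ owner s∈T)

  resolving-bound : ∀ T → Resolving C T → k ≤ length T
  resolving-bound T res = subst (k ≤_) (length-map owner T)
    (pairwise-cover-bound (map owner T) (owners-cover T res))

module UpperBound (m : ℕ) (σ : Fin (suc (suc (suc m))) → Fin (suc (suc (suc m))))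
                  (bij : Bijective _≡_ _≡_ σ) where
  open FunctigraphOfComplete σ
  open Inverse σ bij

  landmark : Fin (suc (suc m)) → V C
  landmark k = inj₁ (fsuc k)

  S : List (V C)
  S = map landmark (allFin _)

  landmark∈S : ∀ k → landmark k ∈ S
  landmark∈S k = ∈-map⁺ landmark (∈-allFin k)

  S-unique : Unique S
  S-unique = map⁺ (λ { refl → refl }) (allFin⁺ _)

  S-length : length S ≡ suc (suc m)
  S-length = trans (length-map landmark (allFin _)) (length-tabulate id)

  -- Two copy-1 vertices: one of them is a landmark (distance 0 versus 1).
  separate-clique : ∀ a b → a ≢ b → Separated C S (inj₁ a) (inj₁ b)
  separate-clique a (fsuc k) a≢b =
    landmark k , landmark∈S k , 1 , 0 , dist-clique a≢b , dist-refl C _ , λ ()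
  separate-clique (fsuc k) fzero a≢b =
    separated-sym C (separate-clique fzero (fsuc k) (a≢b ∘ sym))
  separate-clique fzero fzero a≢b = contradiction refl a≢b

  -- Since σ is injective, v_b is matched to at most one of u_1, u_2 (here n ≥ 3 is used).
  unmatched-landmark : ∀ b → ∃ λ k → b ≢ σ (fsuc k)
  unmatched-landmark b with b ≟ σ (fsuc fzero)
  ... | no b≢σ1  = fzero , b≢σ1
  ... | yes b≡σ1 = fsuc fzero , λ b≡σ2 → one≢two (proj₁ bij (trans (sym b≡σ1) b≡σ2))
    where
    one≢two : fsuc {suc (suc m)} fzero ≢ fsuc (fsuc fzero)
    one≢two ()

  -- u_a and v_b: an unmatched landmark of v_b is at distance 2 from v_b, ≤ 1 from u_a.
  separate-sides : ∀ a b → Separated C S (inj₁ a) (inj₂ b)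
  separate-sides a b with unmatched-landmark b
  ... | k , b≢σk with dist-clique-≤1 a (fsuc k)
  ...   | d , Dist-a , d≤1 =
    landmark k , landmark∈S k , d , 2 , Dist-a , dist-unmatched b≢σk , λ { refl → two≰one d≤1 }
    where
    two≰one : ¬ 2 ≤ 1
    two≰one (s≤s ())

  separate-by-partner : ∀ {a b} k → a ≡ σ (fsuc k) → a ≢ b → Separated C S (inj₂ a) (inj₂ b)
  separate-by-partner k a≡σk a≢b =
    landmark k , landmark∈S k , 1 , 2 , dist-matched a≡σk ,
    dist-unmatched (λ b≡σk → a≢b (trans a≡σk (sym b≡σk))) , λ ()

  -- At most one of v_a, v_b is matched to u_0, so one of them has a landmark partner.
  separate-copy₂ : ∀ a b → a ≢ b → Separated C S (inj₂ a) (inj₂ b)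
  separate-copy₂ a b a≢b with σ⁻¹ a in σ⁻¹a≡ | σ⁻¹ b in σ⁻¹b≡
  ... | fsuc k | _ = separate-by-partner k (σ⁻¹-partner σ⁻¹a≡) a≢b
  ... | fzero | fsuc k = separated-sym C (separate-by-partner k (σ⁻¹-partner σ⁻¹b≡) (a≢b ∘ sym))
  ... | fzero | fzero = contradiction (begin
    a               ≡⟨ sym (σ∘σ⁻¹ a) ⟩
    σ (σ⁻¹ a)       ≡⟨ cong σ (trans σ⁻¹a≡ (sym σ⁻¹b≡)) ⟩
    σ (σ⁻¹ b)       ≡⟨ σ∘σ⁻¹ b ⟩
    b               ∎) a≢b
    where open ≡-Reasoning

  S-resolving : Resolving C S
  S-resolving (inj₁ a) (inj₁ b) a≢b = separate-clique a b (a≢b ∘ cong inj₁)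
  S-resolving (inj₁ a) (inj₂ b) _   = separate-sides a b
  S-resolving (inj₂ a) (inj₁ b) _   = separated-sym C (separate-sides b a)
  S-resolving (inj₂ a) (inj₂ b) a≢b = separate-copy₂ a b (a≢b ∘ cong inj₂)

corollary3p3 : (n : ℕ) → 3 ≤ n → (σ : Fin n → Fin n) → Bijective _≡_ _≡_ σ →
    MetricDim (Functigraph (K n) σ) (n ∸ 1)
corollary3p3 (suc (suc (suc m))) (s≤s (s≤s (s≤s _))) σ bij =
  (S , S-unique , S-resolving , S-length) ,
  λ T _ T-resolving → resolving-bound T T-resolving
  where
  open UpperBound m σ bij
  open LowerBound σ bij
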